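{- For every integer $r\ge3$, $\theta(\overrightarrow{K_r})=1+\frac{1}{r-2}$.
   Context: Mixed graphs: finite vertex set, at most one edge on each pair of distinct vertices, each edge undirected or directed (tail $\to$ head). $\alpha(G),\beta(G)$ are the numbers of undirected and directed edges divided by $\binom{v(G)}2$. $F\subseteq G$ means there is an injection $\phi:V(F)\to V(G)$ sending undirected edges of $F$ to pairs joined by an edge of either type and each directed edge $u\to v$ of $F$ to the directed edge $\phi(u)\to\phi(v)$ of $G$. $\theta(F)$ is the maximum $\rho$ with $\limsup_n\max\{\alpha(G)+\rho\beta(G):G\ F\text{ -free},\ v(G)=n\}\le1$ ($\theta(F)=\infty$ if $\max\beta(G)\to0$). $\overrightarrow{K_r}$ is the complete graph on $r$ vertices with exactly one edge directed and all others undirected.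
   Formalization: The values of ρ over which θ is maximized, and the error margins in the limsup condition, range over the rationals. -}

module Defs where

open import Data.Nat using (ℕ; zero; suc; _<ᵇ_; _∸_) renaming (_≤_ to _≤ℕ_)
open import Data.Nat.Combinatorics using (_C_)
open import Data.Fin using (Fin; toℕ; zero; suc) renaming (_≟_ to _≟F_)
open import Relation.Nullary using (yes; no)
open import Data.Empty using (⊥-elim)
open import Data.List using (List; map; allFin)
open import Data.Nat.ListAction using (sum)
open import Data.Bool using (if_then_else_)
open import Data.Integer using (+_)
open import Data.Rational using (ℚ; 0ℚ; 1ℚ; _/_; _+_; _*_; _≤_; Positive)
open import Data.Product using (Σ; ∃; _×_)
open import Relation.Nullary using (¬_)
open import Relation.Binary.PropositionalEquality using (_≡_; _≢_; refl; sym)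
open import Function.Definitions using (Injective)

-- Adjacency status of an ordered pair (i , j):
-- none = no edge, und = undirected edge, out = directed edge i → j, inn = directed edge j → i.
data Adj : Set where
  none und out inn : Adj

rev : Adj → Adj
rev none = none
rev und  = und
rev out  = inn
rev inn  = out

record MixedGraph (n : ℕ) : Set where
  field
    adj      : Fin n → Fin n → Adj
    loopless : ∀ i → adj i i ≡ none
    skew     : ∀ i j → adj j i ≡ rev (adj i j)
open MixedGraph public

-- a / b as a rational (b = 0 gives 0; only used with b > 0).
frac : ℕ → ℕ → ℚ
frac a zero    = 0ℚ
frac a (suc b) = (+ a) / suc b

sumPairs : ∀ {n} → (Fin n → Fin n → ℕ) → ℕ
sumPairs {n} f =
  sum (map (λ i → sum (map (λ j → if toℕ i <ᵇ toℕ j then f i j else 0) (allFin n))) (allFin n))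

isUnd : Adj → ℕ
isUnd und = 1
isUnd _   = 0

isDir : Adj → ℕ
isDir out = 1
isDir inn = 1
isDir _   = 0

α : ∀ {n} → MixedGraph n → ℚ
α {n} G = frac (sumPairs (λ i j → isUnd (adj G i j))) (n C 2)

β : ∀ {n} → MixedGraph n → ℚ
β {n} G = frac (sumPairs (λ i j → isDir (adj G i j))) (n C 2)

_⊆_ : ∀ {k n} → MixedGraph k → MixedGraph n → Set
_⊆_ {k} {n} F G = Σ (Fin k → Fin n) λ φ → Injective _≡_ _≡_ φ ×
  (∀ u v → adj F u v ≡ und → adj G (φ u) (φ v) ≢ none) ×
  (∀ u v → adj F u v ≡ out → adj G (φ u) (φ v) ≡ out)

Free : ∀ {k n} → MixedGraph k → MixedGraph n → Set
Free F G = ¬ (F ⊆ G)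

-- limsup_n max{ α(G) + ρ β(G) : G F-free, v(G) = n } ≤ 1
LimsupAtMostOne : ∀ {k} → MixedGraph k → ℚ → Set
LimsupAtMostOne F ρ = ∀ (ε : ℚ) → Positive ε → ∃ λ (N : ℕ) → ∀ (n : ℕ) → N ≤ℕ n →
  ∀ (G : MixedGraph n) → Free F G → α G + ρ * β G ≤ 1ℚ + ε

-- θ(F) = ρ₀ : ρ₀ is the maximum of { ρ : limsup ≤ 1 } (ρ ranging over ℚ)
ThetaIs : ∀ {k} → MixedGraph k → ℚ → Set
ThetaIs F ρ₀ = LimsupAtMostOne F ρ₀ × (∀ ρ → LimsupAtMostOne F ρ → ρ ≤ ρ₀)

-- K_r with exactly one directed edge, 0 → 1, all other pairs undirected
KrAdj : ∀ {r} → Fin r → Fin r → Adj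
KrAdj zero zero = none
KrAdj zero (suc zero) = out
KrAdj (suc zero) zero = inn
KrAdj zero (suc (suc _)) = und
KrAdj (suc (suc _)) zero = und
KrAdj (suc zero) (suc zero) = none
KrAdj (suc zero) (suc (suc _)) = und
KrAdj (suc (suc _)) (suc zero) = und
KrAdj (suc (suc i)) (suc (suc j)) with i ≟F j
... | yes _ = none
... | no _ = und

KrAdj-loopless : ∀ {r} (i : Fin r) → KrAdj i i ≡ none
KrAdj-loopless zero = refl
KrAdj-loopless (suc zero) = refl
KrAdj-loopless (suc (suc i)) with i ≟F i
... | yes _ = refl
... | no ¬p = ⊥-elim (¬p refl)

KrAdj-skew : ∀ {r} (i j : Fin r) → KrAdj j i ≡ rev (KrAdj i j)
KrAdj-skew zero zero = refl
KrAdj-skew zero (suc zero) = refl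
KrAdj-skew (suc zero) zero = refl
KrAdj-skew zero (suc (suc _)) = refl
KrAdj-skew (suc (suc _)) zero = refl
KrAdj-skew (suc zero) (suc zero) = refl
KrAdj-skew (suc zero) (suc (suc _)) = refl
KrAdj-skew (suc (suc _)) (suc zero) = refl
KrAdj-skew (suc (suc i)) (suc (suc j)) with i ≟F j | j ≟F i
... | yes _ | yes _ = refl
... | no _ | no _ = refl
... | yes p | no q = ⊥-elim (q (sym p))
... | no p | yes q = ⊥-elim (p (sym q))

KrArrow : (r : ℕ) → MixedGraph r
KrArrow r = record { adj = KrAdj ; loopless = KrAdj-loopless ; skew = KrAdj-skew }

-- Write r = t + 2 with t ≥ 1 and ρ₀ = 1 + 1/t.
-- Upper bound: in a K_r-arrow-free graph every r-clique of the underlying graph is entirely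
-- undirected. Weighting undirected edges by t and directed edges by t + 1, a weighted Turán
-- argument (split off a (t+1)-clique and induct on the rest; without such a clique compare with
-- the case t in which every edge weighs t + 1) bounds the total weight by t·n²/2, which reads
-- α + ρ₀β ≤ n/(n − 1).
-- Lower bound: the balanced complete (t+1)-partite graph, with every edge directed, contains no
-- K_r at all and has β ≥ t/(t + 1) = 1/ρ₀, so no ρ > ρ₀ keeps α + ρβ ≤ 1 + o(1).

module Submission where

open import Defs
open import Data.Nat using (ℕ)
open import Data.Bool using (Bool; true; false)
open import Relation.Binary.Definitions using (DecidableEquality)
open import Relation.Binary.PropositionalEquality using (_≡_; _≢_; refl)

module ListSum where

  open import Data.Nat using (ℕ; suc; _+_; _*_; _≤_; z≤n)
  open import Data.Nat.Properties
  open import Data.Nat.ListAction using (sum)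
  open import Data.Nat.ListAction.Properties using (sum-↭)
  open import Data.List using (List; []; _∷_; map; _++_; length)
  open import Data.List.Membership.Propositional using (_∈_)
  open import Data.List.Relation.Unary.Any using (Any; here; there)
  open import Data.List.Relation.Binary.Permutation.Propositional using (_↭_)
  open import Data.List.Relation.Binary.Permutation.Propositional.Properties using (map⁺)
  open import Relation.Binary.PropositionalEquality
  open import Data.Nat.Tactic.RingSolver using (solve-∀)

  module _ {A : Set} where

    ∑ : List A → (A → ℕ) → ℕ
    ∑ L f = sum (map f L)

    ∑-cong : ∀ L {f g : A → ℕ} → (∀ x → x ∈ L → f x ≡ g x) → ∑ L f ≡ ∑ L g
    ∑-cong []      f≡g = refl
    ∑-cong (x ∷ L) f≡g = cong₂ _+_ (f≡g x (here refl)) (∑-cong L (λ y y∈L → f≡g y (there y∈L)))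

    ∑-mono-≤ : ∀ L {f g : A → ℕ} → (∀ x → x ∈ L → f x ≤ g x) → ∑ L f ≤ ∑ L g
    ∑-mono-≤ []      f≤g = z≤n
    ∑-mono-≤ (x ∷ L) f≤g = +-mono-≤ (f≤g x (here refl)) (∑-mono-≤ L (λ y y∈L → f≤g y (there y∈L)))

    ∑-const : ∀ L c → ∑ L (λ _ → c) ≡ length L * c
    ∑-const []      c = refl
    ∑-const (x ∷ L) c = cong (c +_) (∑-const L c)

    ∑-zero : ∀ L → ∑ L (λ _ → 0) ≡ 0
    ∑-zero L = trans (∑-const L 0) (*-zeroʳ (length L))

    ∑-≤-length* : ∀ L {f : A → ℕ} B → (∀ x → x ∈ L → f x ≤ B) → ∑ L f ≤ length L * B
    ∑-≤-length* L B f≤B = ≤-trans (∑-mono-≤ L f≤B) (≤-reflexive (∑-const L B))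

    ∑+bound≤length* : ∀ L {f : A → ℕ} B → (∀ x → x ∈ L → f x ≤ B) →
                      Any (λ x → f x ≡ 0) L → ∑ L f + B ≤ length L * B
    ∑+bound≤length* (x ∷ L) {f} B f≤B (here fx≡0) = begin
      f x + ∑ L f + B   ≡⟨ cong (λ z → z + ∑ L f + B) fx≡0 ⟩
      ∑ L f + B         ≡⟨ +-comm (∑ L f) B ⟩
      B + ∑ L f         ≤⟨ +-monoʳ-≤ B (∑-≤-length* L B (λ y y∈L → f≤B y (there y∈L))) ⟩
      B + length L * B  ∎
      where open ≤-Reasoning
    ∑+bound≤length* (x ∷ L) {f} B f≤B (there zero∈L) = begin
      f x + ∑ L f + B      ≡⟨ +-assoc (f x) (∑ L f) B ⟩
      f x + (∑ L f + B)    ≤⟨ +-mono-≤ (f≤B x (here refl))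
                                       (∑+bound≤length* L B (λ y y∈L → f≤B y (there y∈L)) zero∈L) ⟩
      B + length L * B     ∎
      where open ≤-Reasoning

    ∑-distrib-+ : ∀ L (f g : A → ℕ) → ∑ L (λ x → f x + g x) ≡ ∑ L f + ∑ L g
    ∑-distrib-+ []      f g = refl
    ∑-distrib-+ (x ∷ L) f g rewrite ∑-distrib-+ L f g = interchange (f x) (g x) (∑ L f) (∑ L g)
      where
        interchange : ∀ a b c d → (a + b) + (c + d) ≡ (a + c) + (b + d)
        interchange = solve-∀

    ∑-distribˡ-* : ∀ L k (f : A → ℕ) → ∑ L (λ x → k * f x) ≡ k * ∑ L f
    ∑-distribˡ-* []      k f = sym (*-zeroʳ k)
    ∑-distribˡ-* (x ∷ L) k f rewrite ∑-distribˡ-* L k f = sym (*-distribˡ-+ k (f x) (∑ L f))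

    ∑-++ : ∀ L M (f : A → ℕ) → ∑ (L ++ M) f ≡ ∑ L f + ∑ M f
    ∑-++ []      M f = refl
    ∑-++ (x ∷ L) M f rewrite ∑-++ L M f = sym (+-assoc (f x) (∑ L f) (∑ M f))

    ∑-↭ : ∀ {L M} (f : A → ℕ) → L ↭ M → ∑ L f ≡ ∑ M f
    ∑-↭ f L↭M = sum-↭ (map⁺ f L↭M)

  ∑-comm : ∀ {A B : Set} (L : List A) (M : List B) (h : A → B → ℕ) →
           ∑ L (λ x → ∑ M (h x)) ≡ ∑ M (λ y → ∑ L (λ x → h x y))
  ∑-comm []      M h = sym (∑-zero M)
  ∑-comm (x ∷ L) M h rewrite ∑-comm L M h = sym (∑-distrib-+ M (h x) (λ y → ∑ L (λ x → h x y)))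

  module _ {A : Set} where

    ∑∑ : List A → (A → A → ℕ) → ℕ
    ∑∑ L f = ∑ L (λ x → ∑ L (f x))

    ∑∑-↭ : ∀ f {L M : List A} → L ↭ M → ∑∑ L f ≡ ∑∑ M f
    ∑∑-↭ f {L} {M} L↭M = trans (∑-cong L (λ x _ → ∑-↭ (f x) L↭M)) (∑-↭ (λ x → ∑ M (f x)) L↭M)

    ∑∑-++ : ∀ f (L M : List A) →
            ∑∑ (L ++ M) f ≡ ∑∑ L f + ∑ L (λ x → ∑ M (f x)) + ∑ M (λ x → ∑ L (f x)) + ∑∑ M f
    ∑∑-++ f L M = begin
      ∑ (L ++ M) (λ x → ∑ (L ++ M) (f x))
        ≡⟨ ∑-cong (L ++ M) (λ x _ → ∑-++ L M (f x)) ⟩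
      ∑ (L ++ M) (λ x → ∑ L (f x) + ∑ M (f x))
        ≡⟨ ∑-++ L M _ ⟩
      ∑ L (λ x → ∑ L (f x) + ∑ M (f x)) + ∑ M (λ x → ∑ L (f x) + ∑ M (f x))
        ≡⟨ cong₂ _+_ (∑-distrib-+ L _ _) (∑-distrib-+ M _ _) ⟩
      (∑∑ L f + ∑ L (λ x → ∑ M (f x))) + (∑ M (λ x → ∑ L (f x)) + ∑∑ M f)
        ≡⟨ +-assoc (∑∑ L f + ∑ L (λ x → ∑ M (f x))) _ _ ⟨
      ∑∑ L f + ∑ L (λ x → ∑ M (f x)) + ∑ M (λ x → ∑ L (f x)) + ∑∑ M f
        ∎
      where open ≡-Reasoning

    ∑∑-distribˡ-* : ∀ k f (L : List A) → ∑∑ L (λ x y → k * f x y) ≡ k * ∑∑ L f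
    ∑∑-distribˡ-* k f L = trans (∑-cong L (λ x _ → ∑-distribˡ-* L k (f x))) (∑-distribˡ-* L k (λ x → ∑ L (f x)))

    ∑∑-mono-≤ : ∀ {f g} (L : List A) → (∀ x y → f x y ≤ g x y) → ∑∑ L f ≤ ∑∑ L g
    ∑∑-mono-≤ L f≤g = ∑-mono-≤ L (λ x _ → ∑-mono-≤ L (λ y _ → f≤g x y))

    ∑∑-≤-offDiagonal : ∀ s f → (∀ x y → f x y ≤ s) → (∀ x → f x x ≡ 0) →
             ∀ (C : List A) → ∑∑ C f + s * length C ≤ s * (length C * length C)
    ∑∑-≤-offDiagonal s f f≤s f-diag []      = ≤-refl
    ∑∑-≤-offDiagonal s f f≤s f-diag (c ∷ C) = begin
      (f c c + ∑ C (f c)) + ∑ C (λ x → f x c + ∑ C (f x)) + s * suc k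
        ≡⟨ cong₂ (λ a b → (a + ∑ C (f c)) + b + s * suc k) (f-diag c) (∑-distrib-+ C (λ x → f x c) (λ x → ∑ C (f x))) ⟩
      ∑ C (f c) + (∑ C (λ x → f x c) + ∑∑ C f) + s * suc k
        ≡⟨ regroup (∑ C (f c)) (∑ C (λ x → f x c)) (∑∑ C f) s k ⟩
      ∑ C (f c) + ∑ C (λ x → f x c) + (∑∑ C f + s * k) + s
        ≤⟨ +-monoˡ-≤ s (+-mono-≤ (+-mono-≤ (∑-≤-length* C s (λ y _ → f≤s c y)) (∑-≤-length* C s (λ y _ → f≤s y c)))
                                  (∑∑-≤-offDiagonal s f f≤s f-diag C)) ⟩
      k * s + k * s + s * (k * k) + s
        ≡⟨ square s k ⟩
      s * (suc k * suc k)
        ∎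
      where
        open ≤-Reasoning
        k = length C
        regroup : ∀ a b c s k → a + (b + c) + s * suc k ≡ a + b + (c + s * k) + s
        regroup = solve-∀
        square : ∀ s k → k * s + k * s + s * (k * k) + s ≡ s * (suc k * suc k)
        square = solve-∀

module ListPermutation {A : Set} where

  open import Data.Product using (∃; _,_)
  open import Data.Empty using (⊥-elim)
  open import Data.Fin using (Fin; zero; suc)
  open import Data.Nat using (_+_)
  open import Data.List using (List; []; _∷_; _++_; length; lookup)
  open import Data.List.Properties using (length-++)
  open import Data.List.Membership.Propositional using (_∈_)
  open import Data.List.Membership.Propositional.Properties using (∈-∃++; ∈-lookup)
  open import Data.List.Relation.Unary.Any using (here; there)
  open import Data.List.Relation.Unary.All as All using (All; []; _∷_)
  open import Data.List.Relation.Unary.AllPairs using (AllPairs; []; _∷_)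
  open import Data.List.Relation.Binary.Permutation.Propositional
  open import Data.List.Relation.Binary.Permutation.Propositional.Properties using (shift; ∈-resp-↭; All-resp-↭; ↭-length)
  open import Relation.Binary.PropositionalEquality using (_≡_; _≢_; refl; sym; cong) renaming (trans to ≡-trans)

  ∈⇒↭∷ : ∀ {x : A} {L} → x ∈ L → ∃ λ L′ → L ↭ x ∷ L′
  ∈⇒↭∷ {x} x∈L with ys , zs , refl ← ∈-∃++ x∈L = ys ++ zs , shift x ys zs

  ∈-↭∷ : ∀ {x y : A} {L L′} → L ↭ y ∷ L′ → x ∈ L → y ≢ x → x ∈ L′
  ∈-↭∷ L↭yL′ x∈L y≢x with ∈-resp-↭ L↭yL′ x∈L
  ... | here x≡y   = ⊥-elim (y≢x (sym x≡y))
  ... | there x∈L′ = x∈L′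

  ↭-split : ∀ (C L : List A) → AllPairs _≢_ C → All (_∈ L) C → ∃ λ R → L ↭ C ++ R
  ↭-split []      L _ _ = L , ↭-refl
  ↭-split (c ∷ C) L (c∉C ∷ C-unique) (c∈L ∷ C⊆L)
    with L′ , L↭cL′ ← ∈⇒↭∷ c∈L
    with R , L′↭CR ← ↭-split C L′ C-unique (All.zipWith (λ (c≢x , x∈L) → ∈-↭∷ L↭cL′ x∈L c≢x) (c∉C , C⊆L))
    = R , trans L↭cL′ (prep c L′↭CR)

  ↭-++-length : ∀ {L} (C : List A) {R} → L ↭ C ++ R → length L ≡ length C + length R
  ↭-++-length C L↭CR = ≡-trans (↭-length L↭CR) (length-++ C)

  AllPairs-resp-↭ : ∀ {R : A → A → Set} → (∀ {x y} → R x y → R y x) →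
                    ∀ {L M} → L ↭ M → AllPairs R L → AllPairs R M
  AllPairs-resp-↭ R-sym refl         L-R                     = L-R
  AllPairs-resp-↭ R-sym (prep x p)   (x-R ∷ L-R)             = All-resp-↭ p x-R ∷ AllPairs-resp-↭ R-sym p L-R
  AllPairs-resp-↭ R-sym (swap x y p) ((xy ∷ x-R) ∷ y-R ∷ L-R) =
    (R-sym xy ∷ All-resp-↭ p y-R) ∷ All-resp-↭ p x-R ∷ AllPairs-resp-↭ R-sym p L-R
  AllPairs-resp-↭ R-sym (trans p q)  L-R                     = AllPairs-resp-↭ R-sym q (AllPairs-resp-↭ R-sym p L-R)

  AllPairs-map∈ : ∀ {R S : A → A → Set} {L} → (∀ {x y} → x ∈ L → y ∈ L → R x y → S x y) →
                  AllPairs R L → AllPairs S L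
  AllPairs-map∈ R⇒S []          = []
  AllPairs-map∈ R⇒S (x-R ∷ L-R) =
    All.tabulate (λ y∈L → R⇒S (here refl) (there y∈L) (All.lookup x-R y∈L)) ∷
    AllPairs-map∈ (λ x∈L y∈L → R⇒S (there x∈L) (there y∈L)) L-R

  lookup-injective : ∀ (L : List A) → AllPairs _≢_ L → ∀ i j → lookup L i ≡ lookup L j → i ≡ j
  lookup-injective (x ∷ L) _              zero    zero    _  = refl
  lookup-injective (x ∷ L) (x∉L ∷ _)      zero    (suc j) eq = ⊥-elim (All.lookup x∉L (∈-lookup j) eq)
  lookup-injective (x ∷ L) (x∉L ∷ _)      (suc i) zero    eq = ⊥-elim (All.lookup x∉L (∈-lookup i) (sym eq))
  lookup-injective (x ∷ L) (_ ∷ L-unique) (suc i) (suc j) eq = cong suc (lookup-injective L L-unique i j eq)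

module WeightedTurán
  {V : Set} (_≟_ : DecidableEquality V) (E : V → V → Bool)
  (E-sym : ∀ x y → E x y ≡ E y x) (E-irrefl : ∀ x → E x x ≡ false) where

  open import Data.Nat using (ℕ; zero; suc; _+_; _*_; _≤_; z≤n; s≤s) renaming (_≟_ to _≟ℕ_)
  open import Data.Nat.Properties hiding (_≟_)
  open import Data.Bool using (true; if_then_else_)
  import Data.Bool.Properties as Bool
  open import Data.Product using (∃; _×_; _,_)
  open import Data.Empty using (⊥-elim)
  open import Relation.Nullary using (¬_; Dec; yes; no)
  open import Relation.Nullary.Decidable using (_×-dec_; map′)
  open import Data.List using (List; []; _∷_; [_]; _++_; length; cartesianProductWith)
  open import Data.List.Membership.Propositional using (_∈_; lose)
  open import Data.List.Membership.Propositional.Properties using (∈-cartesianProductWith⁺; ∈-++⁺ʳ)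
  open import Data.List.Membership.DecPropositional _≟_ using (_∈?_)
  open import Data.List.Relation.Unary.Any as Any using (Any; here; there; any?; satisfied)
  open import Data.List.Relation.Unary.All as All using (All; []; _∷_; all?)
  open import Data.List.Relation.Unary.All.Properties using (¬All⇒Any¬)
  open import Data.List.Relation.Unary.AllPairs as AllPairs using (AllPairs; []; _∷_; allPairs?)
  open import Data.List.Relation.Binary.Permutation.Propositional using (_↭_; ↭-sym)
  open import Data.List.Relation.Binary.Permutation.Propositional.Properties using (∈-resp-↭)
  open import Relation.Binary.PropositionalEquality hiding ([_])
  open import Data.Nat.Tactic.RingSolver using (solve-∀)
  open ListSum
  open ListPermutation

  Adjacent : V → V → Set
  Adjacent x y = E x y ≡ true

  adjacent-sym : ∀ {x y} → Adjacent x y → Adjacent y x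
  adjacent-sym {x} {y} xy = trans (E-sym y x) xy

  adjacent⇒≢ : ∀ {x y} → Adjacent x y → x ≢ y
  adjacent⇒≢ {x} xx refl with () ← trans (sym xx) (E-irrefl x)

  IsClique : List V → Set
  IsClique = AllPairs Adjacent

  clique⇒unique : ∀ {C} → IsClique C → AllPairs _≢_ C
  clique⇒unique = AllPairs.map adjacent⇒≢

  clique⇒adjacent : ∀ {C x y} → IsClique C → x ∈ C → y ∈ C → x ≢ y → Adjacent x y
  clique⇒adjacent (_   ∷ _)        (here refl) (here refl) x≢y = ⊥-elim (x≢y refl)
  clique⇒adjacent (x~C ∷ _)        (here refl) (there y∈C) _   = All.lookup x~C y∈C
  clique⇒adjacent (y~C ∷ _)        (there x∈C) (here refl) _   = adjacent-sym (All.lookup y~C x∈C)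
  clique⇒adjacent (_   ∷ C-clique) (there x∈C) (there y∈C) x≢y = clique⇒adjacent C-clique x∈C y∈C x≢y

  Marked : (V → V → Bool) → List V → Set
  Marked u = AllPairs (λ x y → u x y ≡ true)

  CliqueIn : List V → ℕ → List V → Set
  CliqueIn L s C = All (_∈ L) C × length C ≡ s × IsClique C

  CliquesMarked : ℕ → (V → V → Bool) → List V → Set
  CliquesMarked s u L = ∀ C → CliqueIn L s C → Marked u C

  cliquesMarked-⊆ : ∀ {s u L M} → (∀ {x} → x ∈ M → x ∈ L) → CliquesMarked s u L → CliquesMarked s u M
  cliquesMarked-⊆ M⊆L marked C (C⊆M , |C| , C-clique) = marked C (All.map M⊆L C⊆M , |C| , C-clique)

  words : List V → ℕ → List (List V)
  words L zero    = [ [] ]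
  words L (suc k) = cartesianProductWith _∷_ L (words L k)

  ∈-words : ∀ L C → All (_∈ L) C → C ∈ words L (length C)
  ∈-words L []      []            = here refl
  ∈-words L (c ∷ C) (c∈L ∷ C⊆L) = ∈-cartesianProductWith⁺ _∷_ c∈L (∈-words L C C⊆L)

  cliqueIn? : ∀ L s C → Dec (CliqueIn L s C)
  cliqueIn? L s C = all? (_∈? L) C ×-dec (length C ≟ℕ s) ×-dec allPairs? (λ x y → E x y Bool.≟ true) C

  ∃cliqueIn? : ∀ L s → Dec (∃ (CliqueIn L s))
  ∃cliqueIn? L s = map′ satisfied witness-in-words (any? (cliqueIn? L s) (words L s))
    where
      witness-in-words : ∃ (CliqueIn L s) → Any (CliqueIn L s) (words L s)
      witness-in-words (C , C-in-L@(C⊆L , refl , _)) = lose (∈-words L C C⊆L) C-in-L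

  weight : ℕ → (V → V → Bool) → V → V → ℕ
  weight t u x y = if E x y then (if u x y then t else suc t) else 0

  module _ (t : ℕ) (u : V → V → Bool) where

    weight-≤ : ∀ x y → weight t u x y ≤ suc t
    weight-≤ x y with E x y | u x y
    ... | false | _     = z≤n
    ... | true  | true  = n≤1+n t
    ... | true  | false = ≤-refl

    weight-diag : ∀ x → weight t u x x ≡ 0
    weight-diag x rewrite E-irrefl x = refl

    weight-sym : (∀ x y → u x y ≡ u y x) → ∀ x y → weight t u x y ≡ weight t u y x
    weight-sym u-sym x y rewrite E-sym x y | u-sym x y = refl

    weight-nonadjacent : ∀ x y → ¬ Adjacent x y → weight t u x y ≡ 0
    weight-nonadjacent x y ¬xy with E x y
    ... | true  = ⊥-elim (¬xy refl)
    ... | false = refl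

    weight-marked : ∀ x y → Adjacent x y → u x y ≡ true → weight t u x y ≡ t
    weight-marked x y xy uxy rewrite xy | uxy = refl

    -- If y is adjacent to all of C, then y ∷ C is a (t+2)-clique and every weight is t;
    -- otherwise one weight is 0 and the other t are at most t + 1.
    ∑-weight-into-clique-≤ : ∀ {L C y} → CliquesMarked (2 + t) u L → CliqueIn L (suc t) C → y ∈ L →
                             ∑ C (weight t u y) ≤ suc t * t
    ∑-weight-into-clique-≤ {L} {C} {y} marked (C⊆L , |C| , C-clique) y∈L
      with all? (λ x → E y x Bool.≟ true) C
    ... | yes y~C
      with u-y ∷ _ ← marked (y ∷ C) (y∈L ∷ C⊆L , cong suc |C| , y~C ∷ C-clique) = ≤-reflexive (begin
        ∑ C (weight t u y)    ≡⟨ ∑-cong C (λ x x∈C → weight-marked y x (All.lookup y~C x∈C) (All.lookup u-y x∈C)) ⟩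
        ∑ C (λ _ → t)         ≡⟨ ∑-const C t ⟩
        length C * t          ≡⟨ cong (_* t) |C| ⟩
        suc t * t             ∎)
      where open ≡-Reasoning
    ... | no ¬y~C = +-cancelˡ-≤ (suc t) _ _ (begin
        suc t + ∑ C (weight t u y)   ≡⟨ +-comm (suc t) _ ⟩
        ∑ C (weight t u y) + suc t   ≤⟨ ∑+bound≤length* C (suc t) (λ x _ → weight-≤ y x) some-zero ⟩
        length C * suc t             ≡⟨ cong (_* suc t) |C| ⟩
        suc t * suc t                ≡⟨ *-suc (suc t) t ⟩
        suc t + suc t * t            ∎)
      where
        open ≤-Reasoning
        some-zero : Any (λ x → weight t u y x ≡ 0) C
        some-zero = Any.map (weight-nonadjacent y _) (¬All⇒Any¬ (λ x → E y x Bool.≟ true) C ¬y~C)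

    clique-step : (∀ x y → u x y ≡ u y x) → ∀ {L C R} →
                  CliquesMarked (2 + t) u L → CliqueIn L (suc t) C → L ↭ C ++ R →
                  ∑∑ R (weight t u) ≤ t * (length R * length R) →
                  ∑∑ L (weight t u) ≤ t * (length L * length L)
    clique-step u-sym {L} {C} {R} marked C-in-L@(C⊆L , |C| , C-clique) L↭CR bound-R = begin
      ∑∑ L f
        ≡⟨ ∑∑-↭ f L↭CR ⟩
      ∑∑ (C ++ R) f
        ≡⟨ ∑∑-++ f C R ⟩
      ∑∑ C f + ∑ C (λ x → ∑ R (f x)) + ∑ R (λ y → ∑ C (f y)) + ∑∑ R f
        ≤⟨ sum-of-bounds bound-C bound-CR bound-RC bound-R ⟩
      t * ((suc t + r) * (suc t + r))
        ≡⟨ cong (λ n → t * (n * n)) |L| ⟨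
      t * (length L * length L)
        ∎
      where
        open ≤-Reasoning
        f = weight t u
        r = length R
        |L| : length L ≡ suc t + r
        |L| = trans (↭-++-length C L↭CR) (cong (_+ r) |C|)
        bound-C : ∑∑ C f + suc t * suc t ≤ suc t * (suc t * suc t)
        bound-C = subst (λ k → ∑∑ C f + suc t * k ≤ suc t * (k * k)) |C| (∑∑-≤-offDiagonal (suc t) f weight-≤ weight-diag C)
        bound-RC : ∑ R (λ y → ∑ C (f y)) ≤ r * (suc t * t)
        bound-RC = ∑-≤-length* R (suc t * t) (λ y y∈R →
                     ∑-weight-into-clique-≤ marked C-in-L (∈-resp-↭ (↭-sym L↭CR) (∈-++⁺ʳ C y∈R)))
        bound-CR : ∑ C (λ x → ∑ R (f x)) ≤ r * (suc t * t)
        bound-CR = subst (_≤ r * (suc t * t))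
                     (sym (trans (∑-comm C R f) (∑-cong R (λ y _ → ∑-cong C (λ x _ → weight-sym u-sym x y))))) bound-RC
        sum-of-bounds : ∀ {a b c d} → a + suc t * suc t ≤ suc t * (suc t * suc t) → b ≤ r * (suc t * t) →
                        c ≤ r * (suc t * t) → d ≤ t * (r * r) → a + b + c + d ≤ t * ((suc t + r) * (suc t + r))
        sum-of-bounds {a} {b} {c} {d} a≤ b≤ c≤ d≤ = +-cancelʳ-≤ (suc t * suc t) _ _ (begin
          a + b + c + d + suc t * suc t
            ≡⟨ regroup a b c d (suc t * suc t) ⟩
          (a + suc t * suc t) + b + c + d
            ≤⟨ +-mono-≤ (+-mono-≤ (+-mono-≤ a≤ b≤) c≤) d≤ ⟩
          suc t * (suc t * suc t) + r * (suc t * t) + r * (suc t * t) + t * (r * r)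
            ≡⟨ expand t r ⟩
          t * ((suc t + r) * (suc t + r)) + suc t * suc t
            ∎)
          where
            regroup : ∀ a b c d e → a + b + c + d + e ≡ (a + e) + b + c + d
            regroup = solve-∀
            expand : ∀ t r → suc t * (suc t * suc t) + r * (suc t * t) + r * (suc t * t) + t * (r * r)
                             ≡ t * ((suc t + r) * (suc t + r)) + suc t * suc t
            expand = solve-∀

  unmarked : V → V → Bool
  unmarked _ _ = false

  -- Without (t+2)-cliques, weighting every edge t + 1 is the case t with nothing marked,
  -- and (t + 2)·t ≤ (t + 1)².
  cliqueFree-step : ∀ t u L → ∑∑ L (weight t unmarked) ≤ t * (length L * length L) →
                    ∑∑ L (weight (suc t) u) ≤ suc t * (length L * length L)
  cliqueFree-step t u L bound = *-cancelˡ-≤ (suc t) (begin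
    suc t * ∑∑ L (weight (suc t) u)         ≡⟨ ∑∑-distribˡ-* (suc t) (weight (suc t) u) L ⟨
    ∑∑ L (λ x y → suc t * weight (suc t) u x y)
      ≤⟨ ∑∑-mono-≤ L pointwise ⟩
    ∑∑ L (λ x y → suc (suc t) * weight t unmarked x y)
      ≡⟨ ∑∑-distribˡ-* (suc (suc t)) (weight t unmarked) L ⟩
    suc (suc t) * ∑∑ L (weight t unmarked)  ≤⟨ *-monoʳ-≤ (suc (suc t)) bound ⟩
    suc (suc t) * (t * n²)                  ≤⟨ product-≤-square t n² ⟩
    suc t * (suc t * n²)                    ∎)
    where
      open ≤-Reasoning
      n² = length L * length L
      pointwise : ∀ x y → suc t * weight (suc t) u x y ≤ suc (suc t) * weight t unmarked x y
      pointwise x y with E x y | u x y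
      ... | false | _     = ≤-reflexive (trans (*-zeroʳ (suc t)) (sym (*-zeroʳ (suc (suc t)))))
      ... | true  | true  = *-monoˡ-≤ (suc t) (n≤1+n (suc t))
      ... | true  | false = ≤-reflexive (*-comm (suc t) (suc (suc t)))
      product-≤-square : ∀ t m → suc (suc t) * (t * m) ≤ suc t * (suc t * m)
      product-≤-square t m = begin
        suc (suc t) * (t * m)   ≡⟨ *-assoc (suc (suc t)) t m ⟨
        (suc (suc t) * t) * m   ≤⟨ *-monoˡ-≤ m (n≤1+n (suc (suc t) * t)) ⟩
        suc (suc (suc t) * t) * m ≡⟨ cong (_* m) (square t) ⟩
        (suc t * suc t) * m     ≡⟨ *-assoc (suc t) (suc t) m ⟩
        suc t * (suc t * m)     ∎
        where
          square : ∀ t → suc (suc (suc t) * t) ≡ suc t * suc t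
          square = solve-∀

  weighted-turán : ∀ t u → (∀ x y → u x y ≡ u y x) → ∀ L → CliquesMarked (2 + t) u L →
                   ∑∑ L (weight t u) ≤ t * (length L * length L)
  weighted-turán zero u u-sym L marked =
    ≤-reflexive (trans (∑-cong L (λ x x∈L → trans (∑-cong L (λ y y∈L → weight-vanishes x∈L y∈L)) (∑-zero L))) (∑-zero L))
    where
      weight-vanishes : ∀ {x y} → x ∈ L → y ∈ L → weight zero u x y ≡ 0
      weight-vanishes {x} {y} x∈L y∈L with E x y in xy
      ... | false = refl
      ... | true
        with (uxy ∷ []) ∷ _ ← marked (x ∷ y ∷ []) ((x∈L ∷ y∈L ∷ []) , refl , (xy ∷ []) ∷ [] ∷ [])
        rewrite uxy = refl
  weighted-turán (suc t) u u-sym L₀ marked₀ = go (length L₀) L₀ ≤-refl marked₀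
    where
      go : ∀ fuel L → length L ≤ fuel → CliquesMarked (3 + t) u L →
           ∑∑ L (weight (suc t) u) ≤ suc t * (length L * length L)
      go zero       []  _    _      = z≤n
      go (suc fuel) L   |L|≤ marked with ∃cliqueIn? L (2 + t)
      ... | no ∄C = cliqueFree-step t u L
                      (weighted-turán t unmarked (λ _ _ → refl) L (λ C C-in-L → ⊥-elim (∄C (C , C-in-L))))
      ... | yes (C , C-in-L@(C⊆L , |C| , C-clique))
        with R , L↭CR ← ↭-split C L (clique⇒unique C-clique) C⊆L
        = clique-step (suc t) u u-sym marked C-in-L L↭CR (go fuel R |R|≤ (cliquesMarked-⊆ R⊆L marked))
        where
          R⊆L : ∀ {x} → x ∈ R → x ∈ L
          R⊆L x∈R = ∈-resp-↭ (↭-sym L↭CR) (∈-++⁺ʳ C x∈R)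
          |R|≤ : length R ≤ fuel
          |R|≤ = ≤-pred (begin
            suc (length R)             ≤⟨ s≤s (m≤n+m (length R) (suc t)) ⟩
            2 + t + length R           ≡⟨ cong (_+ length R) |C| ⟨
            length C + length R        ≡⟨ ↭-++-length C L↭CR ⟨
            length L                   ≤⟨ |L|≤ ⟩
            suc fuel                   ∎)
            where open ≤-Reasoning

module PairSums where

  open import Data.Nat using (ℕ; _+_; _<_; _<ᵇ_)
  open import Data.Nat.Properties using (<-cmp; <⇒<ᵇ; <ᵇ⇒<; +-identityʳ)
  open import Data.Bool using (true; false; if_then_else_; T)
  open import Data.Empty using (⊥-elim)
  open import Relation.Nullary using (¬_)
  open import Data.Fin using (Fin; toℕ)
  open import Data.Fin.Properties using (toℕ-injective)
  open import Data.List using (allFin)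
  open import Relation.Binary.PropositionalEquality
  open import Relation.Binary.Definitions using (tri<; tri≈; tri>)
  open ListSum

  <ᵇ-true : ∀ {m n} → m < n → (m <ᵇ n) ≡ true
  <ᵇ-true {m} {n} m<n with m <ᵇ n | <⇒<ᵇ m<n
  ... | true | _ = refl

  <ᵇ-false : ∀ {m n} → ¬ m < n → (m <ᵇ n) ≡ false
  <ᵇ-false {m} {n} m≮n with m <ᵇ n in eq
  ... | false = refl
  ... | true  = ⊥-elim (m≮n (<ᵇ⇒< m n (subst T (sym eq) _)))

  ∑∑-allFin≡sumPairs+sumPairs : ∀ {n} (g : Fin n → Fin n → ℕ) → (∀ i j → g i j ≡ g j i) → (∀ i → g i i ≡ 0) →
                                ∑∑ (allFin n) g ≡ sumPairs g + sumPairs g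
  ∑∑-allFin≡sumPairs+sumPairs {n} g g-sym g-diag = begin
    ∑ A (λ i → ∑ A (g i))
      ≡⟨ ∑-cong A (λ i _ → ∑-cong A (λ j _ → split i j)) ⟩
    ∑ A (λ i → ∑ A (λ j → upper i j + upper j i))
      ≡⟨ ∑-cong A (λ i _ → ∑-distrib-+ A (upper i) (λ j → upper j i)) ⟩
    ∑ A (λ i → ∑ A (upper i) + ∑ A (λ j → upper j i))
      ≡⟨ ∑-distrib-+ A _ _ ⟩
    ∑ A (λ i → ∑ A (upper i)) + ∑ A (λ i → ∑ A (λ j → upper j i))
      ≡⟨ cong (sumPairs g +_) (∑-comm A A upper) ⟨
    sumPairs g + sumPairs g
      ∎
    where
      open ≡-Reasoning
      A = allFin n
      upper : Fin n → Fin n → ℕ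
      upper i j = if toℕ i <ᵇ toℕ j then g i j else 0
      split : ∀ i j → g i j ≡ upper i j + upper j i
      split i j with <-cmp (toℕ i) (toℕ j)
      ... | tri< i<j _ i≯j rewrite <ᵇ-true i<j | <ᵇ-false i≯j = sym (+-identityʳ _)
      ... | tri> i≮j _ i>j rewrite <ᵇ-true i>j | <ᵇ-false i≮j = g-sym i j
      ... | tri≈ i≮j i≡j i≯j rewrite <ᵇ-false i≮j | <ᵇ-false i≯j | toℕ-injective i≡j = g-diag j

isEdge : Adj → Bool
isEdge none = false
isEdge _    = true

isUndirected : Adj → Bool
isUndirected und = true
isUndirected _   = false

module _ {A : Set} (f : Adj → A) (f-rev : ∀ a → f (rev a) ≡ f a) {n : ℕ} (G : MixedGraph n) where

  open import Relation.Binary.PropositionalEquality using (sym; trans; cong)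

  rev-invariant-sym : ∀ x y → f (adj G x y) ≡ f (adj G y x)
  rev-invariant-sym x y = sym (trans (cong f (skew G x y)) (f-rev (adj G x y)))

isEdge⇒≢none : ∀ {a} → isEdge a ≡ true → a ≢ none
isEdge⇒≢none () refl

isEdge-rev : ∀ a → isEdge (rev a) ≡ isEdge a
isEdge-rev none = refl
isEdge-rev und  = refl
isEdge-rev out  = refl
isEdge-rev inn  = refl

isUndirected-rev : ∀ a → isUndirected (rev a) ≡ isUndirected a
isUndirected-rev none = refl
isUndirected-rev und  = refl
isUndirected-rev out  = refl
isUndirected-rev inn  = refl

isUnd-rev : ∀ a → isUnd (rev a) ≡ isUnd a
isUnd-rev none = refl
isUnd-rev und  = refl
isUnd-rev out  = refl
isUnd-rev inn  = refl

isDir-rev : ∀ a → isDir (rev a) ≡ isDir a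
isDir-rev none = refl
isDir-rev und  = refl
isDir-rev out  = refl
isDir-rev inn  = refl

module KrArrowEmbeddings where

  open import Data.Nat using (_+_)
  open import Data.Fin using (Fin; zero; suc) renaming (_≟_ to _≟F_)
  open import Data.Product using (_×_; _,_; proj₁)
  open import Data.Empty using (⊥-elim)
  open import Relation.Nullary using (yes; no)
  open import Relation.Binary.PropositionalEquality using (refl; sym; trans; cong)

  KrAdj≡und⇒≢ : ∀ {r} (u v : Fin r) → KrAdj u v ≡ und → u ≢ v
  KrAdj≡und⇒≢ u .u uu refl with () ← trans (sym uu) (KrAdj-loopless u)

  KrAdj≡out⇒ : ∀ {r} (u v : Fin (2 + r)) → KrAdj u v ≡ out → u ≡ zero × v ≡ suc zero
  KrAdj≡out⇒ zero          (suc zero)    _ = refl , refl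
  KrAdj≡out⇒ zero          zero          ()
  KrAdj≡out⇒ zero          (suc (suc _)) ()
  KrAdj≡out⇒ (suc zero)    zero          ()
  KrAdj≡out⇒ (suc zero)    (suc zero)    ()
  KrAdj≡out⇒ (suc zero)    (suc (suc _)) ()
  KrAdj≡out⇒ (suc (suc _)) zero          ()
  KrAdj≡out⇒ (suc (suc _)) (suc zero)    ()
  KrAdj≡out⇒ (suc (suc i)) (suc (suc j)) e with i ≟F j
  KrAdj≡out⇒ (suc (suc i)) (suc (suc j)) () | yes _
  KrAdj≡out⇒ (suc (suc i)) (suc (suc j)) () | no _

  KrAdj≡none⇒≡ : ∀ {r} (u v : Fin r) → KrAdj u v ≡ none → u ≡ v
  KrAdj≡none⇒≡ zero          zero          _ = refl
  KrAdj≡none⇒≡ (suc zero)    (suc zero)    _ = refl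
  KrAdj≡none⇒≡ zero          (suc zero)    ()
  KrAdj≡none⇒≡ zero          (suc (suc _)) ()
  KrAdj≡none⇒≡ (suc zero)    zero          ()
  KrAdj≡none⇒≡ (suc zero)    (suc (suc _)) ()
  KrAdj≡none⇒≡ (suc (suc _)) zero          ()
  KrAdj≡none⇒≡ (suc (suc _)) (suc zero)    ()
  KrAdj≡none⇒≡ (suc (suc i)) (suc (suc j)) e with i ≟F j
  KrAdj≡none⇒≡ (suc (suc i)) (suc (suc j)) _  | yes refl = refl
  KrAdj≡none⇒≡ (suc (suc i)) (suc (suc j)) () | no _

  KrArrow⊆⇒edges : ∀ {r n} {G : MixedGraph n} (emb : KrArrow r ⊆ G) →
                   ∀ i j → i ≢ j → adj G (proj₁ emb i) (proj₁ emb j) ≢ none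
  KrArrow⊆⇒edges {G = G} (φ , _ , und-kept , out-kept) i j i≢j with KrAdj i j in ij
  ... | none = ⊥-elim (i≢j (KrAdj≡none⇒≡ i j ij))
  ... | und  = und-kept i j ij
  ... | out  = isEdge⇒≢none (cong isEdge (out-kept i j ij))
  ... | inn  = isEdge⇒≢none (cong isEdge φiφj≡inn)
    where
      φiφj≡inn : adj G (φ i) (φ j) ≡ inn
      φiφj≡inn = trans (skew G (φ j) (φ i)) (cong rev (out-kept j i (trans (KrAdj-skew i j) (cong rev ij))))

module ArrowFreeGraphs {n : ℕ} (G : MixedGraph n) where

  open import Data.Nat using (suc; _+_; _*_; _≤_)
  open import Data.Nat.Properties using (*-zeroʳ; *-identityʳ; +-identityʳ; module ≤-Reasoning)
  open import Data.Fin using (Fin; cast; toℕ) renaming (_≟_ to _≟F_)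
  open import Data.Fin.Properties using (toℕ-injective; toℕ-cast)
  open import Data.Product using (_,_)
  open import Data.Empty using (⊥-elim)
  open import Data.List using (List; []; _∷_; length; allFin; lookup)
  open import Data.List.Properties using (length-tabulate)
  open import Data.List.Membership.Propositional using (_∈_)
  open import Data.List.Membership.Propositional.Properties using (∈-lookup)
  open import Data.List.Relation.Unary.All using ([]; _∷_)
  open import Data.List.Relation.Unary.AllPairs using ([]; _∷_)
  open import Data.List.Relation.Binary.Permutation.Propositional using (↭-sym)
  open import Data.List.Relation.Binary.Permutation.Propositional.Properties using (∈-resp-↭; ↭-length)
  open import Function using (id)
  open import Relation.Binary.PropositionalEquality
  open ListSum
  open ListPermutation
  open PairSums
  open KrArrowEmbeddings

  edge : Fin n → Fin n → Bool
  edge x y = isEdge (adj G x y)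

  undirected : Fin n → Fin n → Bool
  undirected x y = isUndirected (adj G x y)

  edge-irrefl : ∀ x → edge x x ≡ false
  edge-irrefl x = cong isEdge (loopless G x)

  open WeightedTurán _≟F_ edge (rev-invariant-sym isEdge isEdge-rev G) edge-irrefl

  arrow⇒≢ : ∀ {a b} → adj G a b ≡ out → a ≢ b
  arrow⇒≢ {a} a→b refl with () ← trans (sym a→b) (loopless G a)

  clique-with-arrow⇒KrArrow⊆ : ∀ {t C a b} → IsClique C → length C ≡ 2 + t → a ∈ C → b ∈ C →
                               adj G a b ≡ out → KrArrow (2 + t) ⊆ G
  clique-with-arrow⇒KrArrow⊆ {t} {C} {a} {b} C-clique |C| a∈C b∈C a→b
    with R , C↭abR ← ↭-split (a ∷ b ∷ []) C ((arrow⇒≢ a→b ∷ []) ∷ [] ∷ []) (a∈C ∷ b∈C ∷ [])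
    = φ , φ-injective , edges-kept , arrow-kept
    where
      D = a ∷ b ∷ R
      |D| : 2 + t ≡ length D
      |D| = trans (sym |C|) (↭-length C↭abR)
      φ : Fin (2 + t) → Fin n
      φ k = lookup D (cast |D| k)
      φ-injective : ∀ {i j} → φ i ≡ φ j → i ≡ j
      φ-injective {i} {j} φi≡φj = toℕ-injective (begin
        toℕ i              ≡⟨ toℕ-cast |D| i ⟨
        toℕ (cast |D| i)   ≡⟨ cong toℕ (lookup-injective D D-unique _ _ φi≡φj) ⟩
        toℕ (cast |D| j)   ≡⟨ toℕ-cast |D| j ⟩
        toℕ j              ∎)
        where
          open ≡-Reasoning
          D-unique = AllPairs-resp-↭ ≢-sym C↭abR (clique⇒unique C-clique)
      φ∈C : ∀ k → φ k ∈ C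
      φ∈C k = ∈-resp-↭ (↭-sym C↭abR) (∈-lookup (cast |D| k))
      edges-kept : ∀ u v → KrAdj u v ≡ und → adj G (φ u) (φ v) ≢ none
      edges-kept u v uv =
        isEdge⇒≢none (clique⇒adjacent C-clique (φ∈C u) (φ∈C v) (λ φu≡φv → KrAdj≡und⇒≢ u v uv (φ-injective φu≡φv)))
      arrow-kept : ∀ u v → KrAdj u v ≡ out → adj G (φ u) (φ v) ≡ out
      arrow-kept u v uv with refl , refl ← KrAdj≡out⇒ u v uv = a→b

  free⇒cliquesUndirected : ∀ t → Free (KrArrow (2 + t)) G → CliquesMarked (2 + t) undirected (allFin n)
  free⇒cliquesUndirected t free C (_ , |C| , C-clique) = AllPairs-map∈ undirected-edge C-clique
    where
      undirected-edge : ∀ {x y} → x ∈ C → y ∈ C → Adjacent x y → undirected x y ≡ true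
      undirected-edge {x} {y} x∈C y∈C xy with adj G x y in e
      ... | und = refl
      ... | out = ⊥-elim (free (clique-with-arrow⇒KrArrow⊆ C-clique |C| x∈C y∈C e))
      ... | inn = ⊥-elim (free (clique-with-arrow⇒KrArrow⊆ C-clique |C| y∈C x∈C (trans (skew G x y) (cong rev e))))
      undirected-edge {x} {y} x∈C y∈C () | none

  weight-undirected : ∀ t x y → weight t undirected x y ≡ t * isUnd (adj G x y) + suc t * isDir (adj G x y)
  weight-undirected t x y with adj G x y
  ... | none = sym (cong₂ _+_ (*-zeroʳ t) (*-zeroʳ (suc t)))
  ... | und  = sym (trans (cong₂ _+_ (*-identityʳ t) (*-zeroʳ (suc t))) (+-identityʳ t))
  ... | out  = sym (cong₂ _+_ (*-zeroʳ t) (*-identityʳ (suc t)))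
  ... | inn  = sym (cong₂ _+_ (*-zeroʳ t) (*-identityʳ (suc t)))

  free⇒edge-count-≤ : ∀ t → Free (KrArrow (2 + t)) G →
                      let U = sumPairs (λ i j → isUnd (adj G i j))
                          D = sumPairs (λ i j → isDir (adj G i j))
                      in  t * (U + U) + suc t * (D + D) ≤ t * (n * n)
  free⇒edge-count-≤ t free = begin
    t * (sumPairs gU + sumPairs gU) + suc t * (sumPairs gD + sumPairs gD)
      ≡⟨ cong₂ (λ u d → t * u + suc t * d) (double isUnd isUnd-rev refl) (double isDir isDir-rev refl) ⟨
    t * ∑∑ A gU + suc t * ∑∑ A gD
      ≡⟨ cong₂ _+_ (∑∑-distribˡ-* t gU A) (∑∑-distribˡ-* (suc t) gD A) ⟨
    ∑∑ A (λ x y → t * gU x y) + ∑∑ A (λ x y → suc t * gD x y)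
      ≡⟨ ∑-distrib-+ A _ _ ⟨
    ∑ A (λ x → ∑ A (λ y → t * gU x y) + ∑ A (λ y → suc t * gD x y))
      ≡⟨ ∑-cong A (λ x _ → ∑-distrib-+ A _ _) ⟨
    ∑∑ A (λ x y → t * gU x y + suc t * gD x y)
      ≡⟨ ∑-cong A (λ x _ → ∑-cong A (λ y _ → weight-undirected t x y)) ⟨
    ∑∑ A (weight t undirected)
      ≤⟨ weighted-turán t undirected (rev-invariant-sym isUndirected isUndirected-rev G) A (free⇒cliquesUndirected t free) ⟩
    t * (length A * length A)
      ≡⟨ cong (λ k → t * (k * k)) (length-tabulate {n = n} id) ⟩
    t * (n * n)
      ∎
    where
      open ≤-Reasoning
      A = allFin n
      gU gD : Fin n → Fin n → ℕ
      gU i j = isUnd (adj G i j)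
      gD i j = isDir (adj G i j)
      double : ∀ (f : Adj → ℕ) → (∀ a → f (rev a) ≡ f a) → f none ≡ 0 →
               ∑∑ A (λ i j → f (adj G i j)) ≡ sumPairs (λ i j → f (adj G i j)) + sumPairs (λ i j → f (adj G i j))
      double f f-rev f-none =
        ∑∑-allFin≡sumPairs+sumPairs _ (rev-invariant-sym f f-rev G) (λ i → trans (cong f (loopless G i)) f-none)

module CountingArithmetic where

  open import Data.Nat using (zero; suc; _+_; _*_; _≤_; pred)
  open import Data.Nat.Properties using (*-cancelˡ-≤; *-monoˡ-≤; *-monoʳ-≤; pred[n]≤n; module ≤-Reasoning)
  open import Data.Nat.Combinatorics using (_C_; nCk+nC[k+1]≡[n+1]C[k+1]; nC1≡n)
  open import Relation.Binary.PropositionalEquality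
  open import Data.Nat.Tactic.RingSolver using (solve-∀)

  nC2+nC2≡n*pred[n] : ∀ n → n C 2 + n C 2 ≡ n * pred n
  nC2+nC2≡n*pred[n] zero    = refl
  nC2+nC2≡n*pred[n] (suc n) = begin
    suc n C 2 + suc n C 2              ≡⟨ cong (λ z → z + z) (nCk+nC[k+1]≡[n+1]C[k+1] n 1) ⟨
    (n C 1 + n C 2) + (n C 1 + n C 2)  ≡⟨ cong (λ z → (z + n C 2) + (z + n C 2)) (nC1≡n n) ⟩
    (n + n C 2) + (n + n C 2)          ≡⟨ interchange n (n C 2) ⟩
    (n + n) + (n C 2 + n C 2)          ≡⟨ cong ((n + n) +_) (nC2+nC2≡n*pred[n] n) ⟩
    (n + n) + n * pred n               ≡⟨ step n ⟩
    suc n * n                          ∎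
    where
      open ≡-Reasoning
      interchange : ∀ a b → (a + b) + (a + b) ≡ (a + a) + (b + b)
      interchange = solve-∀
      step : ∀ n → (n + n) + n * pred n ≡ suc n * n
      step zero    = refl
      step (suc n) = lemma n
        where
          lemma : ∀ n → (suc n + suc n) + suc n * n ≡ suc (suc n) * suc n
          lemma = solve-∀

  density-arithmetic : ∀ T m U D B → B + B ≡ (2 + m) * suc m →
                       T * (U + U) + suc T * (D + D) ≤ T * ((2 + m) * (2 + m)) →
                       (U * (T * B) + (T + 1) * D * B) * suc m ≤ (suc m + 1) * (B * (T * B))
  density-arithmetic T m U D B 2B≡ count≤ = *-cancelˡ-≤ 2 (begin
    2 * ((U * (T * B) + (T + 1) * D * B) * suc m)      ≡⟨ e₁ U D T B m ⟩
    (T * (U + U) + suc T * (D + D)) * (B * suc m)      ≤⟨ *-monoˡ-≤ (B * suc m) count≤ ⟩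
    T * (n * n) * (B * suc m)                          ≡⟨ e₂ T B m ⟩
    n * (T * B) * (n * suc m)                          ≡⟨ cong (n * (T * B) *_) 2B≡ ⟨
    n * (T * B) * (B + B)                              ≡⟨ e₃ T B m ⟩
    2 * ((suc m + 1) * (B * (T * B)))                  ∎)
    where
      open ≤-Reasoning
      n = 2 + m
      e₁ : ∀ U D T B m → 2 * ((U * (T * B) + (T + 1) * D * B) * suc m) ≡ (T * (U + U) + suc T * (D + D)) * (B * suc m)
      e₁ = solve-∀
      e₂ : ∀ T B m → T * ((2 + m) * (2 + m)) * (B * suc m) ≡ (2 + m) * (T * B) * ((2 + m) * suc m)
      e₂ = solve-∀
      e₃ : ∀ T B m → (2 + m) * (T * B) * (B + B) ≡ 2 * ((suc m + 1) * (B * (T * B)))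
      e₃ = solve-∀

  lower-density-arithmetic : ∀ t k D B → B + B ≡ k * suc t * pred (k * suc t) → D + D ≡ k * suc t * (k * t) →
                             t * B ≤ D * suc t
  lower-density-arithmetic t k D B 2B≡ 2D≡ = *-cancelˡ-≤ 2 (begin
    2 * (t * B)                      ≡⟨ e₁ t B ⟩
    t * (B + B)                      ≡⟨ cong (t *_) 2B≡ ⟩
    t * (n * pred n)                 ≤⟨ *-monoʳ-≤ t (*-monoʳ-≤ n pred[n]≤n) ⟩
    t * (n * n)                      ≡⟨ e₂ t k ⟩
    n * (k * t) * suc t              ≡⟨ cong (_* suc t) 2D≡ ⟨
    (D + D) * suc t                  ≡⟨ e₃ D t ⟩
    2 * (D * suc t)                  ∎)
    where
      open ≤-Reasoning
      n = k * suc t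
      e₁ : ∀ t B → 2 * (t * B) ≡ t * (B + B)
      e₁ = solve-∀
      e₂ : ∀ t k → t * (k * suc t * (k * suc t)) ≡ k * suc t * (k * t) * suc t
      e₂ = solve-∀
      e₃ : ∀ D t → (D + D) * suc t ≡ 2 * (D * suc t)
      e₃ = solve-∀

module Fraction where

  open import Data.Nat as ℕ using (ℕ; zero; suc)
  import Data.Nat.Properties as ℕ
  open import Data.Integer as ℤ using (+_; +≤+)
  import Data.Integer.Properties as ℤ
  open import Data.Rational using (0ℚ; 1ℚ; _+_; _*_; _≤_; toℚᵘ)
  open import Data.Rational.Properties
  open import Data.Rational.Unnormalised as ℚᵘ using (mkℚᵘ; *≡*; *≤*)
  import Data.Rational.Unnormalised.Properties as ℚᵘ
  open import Relation.Binary.PropositionalEquality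
  open import Data.Nat.Tactic.RingSolver using (solve-∀)

  toℚᵘ-frac : ∀ a c → toℚᵘ (frac a (suc c)) ℚᵘ.≃ mkℚᵘ (+ a) c
  toℚᵘ-frac a c = toℚᵘ-fromℚᵘ (mkℚᵘ (+ a) c)

  frac-≤ : ∀ a b c d → a ℕ.* suc d ℕ.≤ b ℕ.* suc c → frac a (suc c) ≤ frac b (suc d)
  frac-≤ a b c d ad≤bc =
    toℚᵘ-cancel-≤ (ℚᵘ.≤-respˡ-≃ (ℚᵘ.≃-sym (toℚᵘ-frac a c))
                  (ℚᵘ.≤-respʳ-≃ (ℚᵘ.≃-sym (toℚᵘ-frac b d)) (*≤* cross)))
    where
      cross : + a ℤ.* + suc d ℤ.≤ + b ℤ.* + suc c
      cross rewrite sym (ℤ.pos-* a (suc d)) | sym (ℤ.pos-* b (suc c)) = +≤+ ad≤bc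

  frac-≡ : ∀ a b c d → a ℕ.* suc d ≡ b ℕ.* suc c → frac a (suc c) ≡ frac b (suc d)
  frac-≡ a b c d ad≡bc = ≤-antisym (frac-≤ a b c d (ℕ.≤-reflexive ad≡bc)) (frac-≤ b a d c (ℕ.≤-reflexive (sym ad≡bc)))

  frac-nonNeg : ∀ a c → 0ℚ ≤ frac a c
  frac-nonNeg a zero    = ≤-refl
  frac-nonNeg a (suc c) = frac-≤ 0 a 0 c ℕ.z≤n

  frac-+ : ∀ a b c d → frac a (suc c) + frac b (suc d) ≡ frac (a ℕ.* suc d ℕ.+ b ℕ.* suc c) (suc c ℕ.* suc d)
  frac-+ a b c d = toℚᵘ-injective (ℚᵘ.≃-trans (toℚᵘ-homo-+ (frac a (suc c)) (frac b (suc d)))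
    (ℚᵘ.≃-trans (ℚᵘ.+-cong (toℚᵘ-frac a c) (toℚᵘ-frac b d))
    (ℚᵘ.≃-trans (*≡* cross) (ℚᵘ.≃-sym (toℚᵘ-frac (a ℕ.* suc d ℕ.+ b ℕ.* suc c) (ℕ.pred (suc c ℕ.* suc d)))))))
    where
      cross : (+ a ℤ.* + suc d ℤ.+ + b ℤ.* + suc c) ℤ.* + (suc c ℕ.* suc d)
            ≡ + (a ℕ.* suc d ℕ.+ b ℕ.* suc c) ℤ.* (+ suc c ℤ.* + suc d)
      cross = cong₂ ℤ._*_
        (sym (trans (ℤ.pos-+ (a ℕ.* suc d) (b ℕ.* suc c)) (cong₂ ℤ._+_ (ℤ.pos-* a (suc d)) (ℤ.pos-* b (suc c)))))
        (ℤ.pos-* (suc c) (suc d))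

  frac-* : ∀ a b c d → frac a (suc c) * frac b (suc d) ≡ frac (a ℕ.* b) (suc c ℕ.* suc d)
  frac-* a b c d = toℚᵘ-injective (ℚᵘ.≃-trans (toℚᵘ-homo-* (frac a (suc c)) (frac b (suc d)))
    (ℚᵘ.≃-trans (ℚᵘ.*-cong (toℚᵘ-frac a c) (toℚᵘ-frac b d))
    (ℚᵘ.≃-trans (*≡* cross) (ℚᵘ.≃-sym (toℚᵘ-frac (a ℕ.* b) (ℕ.pred (suc c ℕ.* suc d)))))))
    where
      cross : (+ a ℤ.* + b) ℤ.* + (suc c ℕ.* suc d) ≡ + (a ℕ.* b) ℤ.* (+ suc c ℤ.* + suc d)
      cross = cong₂ ℤ._*_ (sym (ℤ.pos-* a b)) (ℤ.pos-* (suc c) (suc d))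

  1+frac : ∀ a c → 1ℚ + frac a (suc c) ≡ frac (suc c ℕ.+ a) (suc c)
  1+frac a c = trans (frac-+ 1 a 0 c) (frac-≡ (1 ℕ.* suc c ℕ.+ a ℕ.* 1) (suc c ℕ.+ a) (ℕ.pred (1 ℕ.* suc c)) c (lemma a c))
    where
      lemma : ∀ a c → (1 ℕ.* suc c ℕ.+ a ℕ.* 1) ℕ.* suc c ≡ (suc c ℕ.+ a) ℕ.* (1 ℕ.* suc c)
      lemma = solve-∀

-- The complete (t+1)-partite graph on the residue classes mod t + 1, every edge directed
-- towards the larger vertex.
module TuránOrientation (t : ℕ) where

  open import Data.Nat using (zero; suc; _+_; _*_; _<_; _≡ᵇ_; _<ᵇ_; z<s; s<s)
  open import Data.Nat.Properties using (<-cmp; n<1+n; +-assoc; +-comm; +-cancelʳ-≡; *-identityʳ; *-suc)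
  open import Data.Nat.DivMod using (_%_; m%n<n; [m+n]%n≡m%n; m<n⇒m%n≡m)
  open import Data.Bool using (if_then_else_)
  open import Data.Product using (_,_)
  open import Data.Fin using (Fin; toℕ; fromℕ<)
  open import Data.Fin.Properties using (toℕ-fromℕ<; pigeonhole) renaming (<⇒≢ to <⇒≢ᶠ)
  open import Data.List using (allFin; length; map; tabulate)
  open import Data.List.Properties using (length-tabulate; map-tabulate)
  open import Data.Nat.ListAction using (sum)
  open import Function using (id; _∘_)
  open import Relation.Binary.PropositionalEquality
  open import Relation.Binary.Definitions using (tri<; tri≈; tri>)
  open ListSum
  open PairSums using (<ᵇ-true; <ᵇ-false; ∑∑-allFin≡sumPairs+sumPairs)
  open KrArrowEmbeddings using (KrArrow⊆⇒edges)

  indicator : Bool → ℕ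
  indicator true  = 1
  indicator false = 0

  ≡ᵇ-refl : ∀ a → (a ≡ᵇ a) ≡ true
  ≡ᵇ-refl zero    = refl
  ≡ᵇ-refl (suc a) = ≡ᵇ-refl a

  ≡ᵇ-sym : ∀ a b → (a ≡ᵇ b) ≡ (b ≡ᵇ a)
  ≡ᵇ-sym zero    zero    = refl
  ≡ᵇ-sym zero    (suc b) = refl
  ≡ᵇ-sym (suc a) zero    = refl
  ≡ᵇ-sym (suc a) (suc b) = ≡ᵇ-sym a b

  part : ∀ {n} → Fin n → ℕ
  part x = toℕ x % suc t

  sameClass : ∀ {n} → Fin n → Fin n → Bool
  sameClass x y = part x ≡ᵇ part y

  orient : ∀ {n} → Fin n → Fin n → Adj
  orient x y = if sameClass x y then none else (if toℕ x <ᵇ toℕ y then out else inn)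

  orient-sameClass : ∀ {n} {x y : Fin n} → part x ≡ part y → orient x y ≡ none
  orient-sameClass {x = x} {y} xy rewrite xy | ≡ᵇ-refl (part y) = refl

  orient-loopless : ∀ {n} (x : Fin n) → orient x x ≡ none
  orient-loopless x = orient-sameClass {x = x} {y = x} refl

  orient-skew : ∀ {n} (x y : Fin n) → orient y x ≡ rev (orient x y)
  orient-skew x y rewrite ≡ᵇ-sym (part y) (part x) with sameClass x y in xy
  ... | true  = refl
  ... | false with <-cmp (toℕ x) (toℕ y)
  ...   | tri< x<y _ x≯y rewrite <ᵇ-true x<y | <ᵇ-false x≯y = refl
  ...   | tri> x≮y _ x>y rewrite <ᵇ-true x>y | <ᵇ-false x≮y = refl
  ...   | tri≈ _ x≡y _ with () ← trans (sym xy) (trans (cong (λ z → z % suc t ≡ᵇ part y) x≡y) (≡ᵇ-refl (part y)))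

  turánOrientation : (n : ℕ) → MixedGraph n
  turánOrientation n = record { adj = orient ; loopless = orient-loopless ; skew = orient-skew }

  turánOrientation-free : ∀ n → Free (KrArrow (2 + t)) (turánOrientation n)
  turánOrientation-free n emb@(φ , _)
    with i , j , i<j , same ← pigeonhole (n<1+n (suc t)) (λ k → fromℕ< (m%n<n (toℕ (φ k)) (suc t)))
    = KrArrow⊆⇒edges {G = turánOrientation n} emb i j (<⇒≢ᶠ i<j) (orient-sameClass {x = φ i} {y = φ j} (begin
        part (φ i)                                       ≡⟨ toℕ-fromℕ< (m%n<n (toℕ (φ i)) (suc t)) ⟨
        toℕ (fromℕ< (m%n<n (toℕ (φ i)) (suc t)))         ≡⟨ cong toℕ same ⟩
        toℕ (fromℕ< (m%n<n (toℕ (φ j)) (suc t)))         ≡⟨ toℕ-fromℕ< (m%n<n (toℕ (φ j)) (suc t)) ⟩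
        part (φ j)                                       ∎))
    where open ≡-Reasoning

  sumBelow : ℕ → (ℕ → ℕ) → ℕ
  sumBelow zero    h = 0
  sumBelow (suc n) h = h 0 + sumBelow n (h ∘ suc)

  ∑-allFin≡sumBelow : ∀ n h → ∑ (allFin n) (h ∘ toℕ) ≡ sumBelow n h
  ∑-allFin≡sumBelow zero    h = refl
  ∑-allFin≡sumBelow (suc n) h = cong (h 0 +_) (begin
    sum (map (h ∘ toℕ) (tabulate {n = n} Fin.suc)) ≡⟨ cong sum (map-tabulate {n = n} Fin.suc (h ∘ toℕ)) ⟩
    sum (tabulate {n = n} (h ∘ suc ∘ toℕ))         ≡⟨ cong sum (map-tabulate {n = n} id (h ∘ suc ∘ toℕ)) ⟨
    ∑ (allFin n) (h ∘ suc ∘ toℕ)                   ≡⟨ ∑-allFin≡sumBelow n (h ∘ suc) ⟩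
    sumBelow n (h ∘ suc)                           ∎)
    where open ≡-Reasoning

  sumBelow-+ : ∀ a b h → sumBelow (a + b) h ≡ sumBelow a h + sumBelow b (λ j → h (a + j))
  sumBelow-+ zero    b h = refl
  sumBelow-+ (suc a) b h = trans (cong (h 0 +_) (sumBelow-+ a b (h ∘ suc))) (sym (+-assoc (h 0) _ _))

  sumBelow-cong : ∀ n {f g} → (∀ j → j < n → f j ≡ g j) → sumBelow n f ≡ sumBelow n g
  sumBelow-cong zero    _   = refl
  sumBelow-cong (suc n) f≡g = cong₂ _+_ (f≡g 0 z<s) (sumBelow-cong n (λ j j<n → f≡g (suc j) (s<s j<n)))

  sumBelow-zero : ∀ n → sumBelow n (λ _ → 0) ≡ 0
  sumBelow-zero zero    = refl
  sumBelow-zero (suc n) = sumBelow-zero n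

  sumBelow-indicator-≡ᵇ : ∀ m p → p < m → sumBelow m (λ j → indicator (p ≡ᵇ j)) ≡ 1
  sumBelow-indicator-≡ᵇ (suc m) zero    _         = cong suc (sumBelow-zero m)
  sumBelow-indicator-≡ᵇ (suc m) (suc p) (s<s p<m) = sumBelow-indicator-≡ᵇ m p p<m

  class-size : ∀ k p → p < suc t → sumBelow (k * suc t) (λ j → indicator (p ≡ᵇ j % suc t)) ≡ k
  class-size zero    p p<t = refl
  class-size (suc k) p p<t = begin
    sumBelow (suc t + k * suc t) h
      ≡⟨ sumBelow-+ (suc t) (k * suc t) h ⟩
    sumBelow (suc t) h + sumBelow (k * suc t) (λ j → h (suc t + j))
      ≡⟨ cong₂ _+_ first-block (trans (sumBelow-cong (k * suc t) shift) (class-size k p p<t)) ⟩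
    1 + k
      ∎
    where
      open ≡-Reasoning
      h = λ j → indicator (p ≡ᵇ j % suc t)
      first-block : sumBelow (suc t) h ≡ 1
      first-block = trans (sumBelow-cong (suc t) (λ j j<t → cong (indicator ∘ (p ≡ᵇ_)) (m<n⇒m%n≡m j<t)))
                          (sumBelow-indicator-≡ᵇ (suc t) p p<t)
      shift : ∀ j → j < k * suc t → h (suc t + j) ≡ h j
      shift j _ = cong (indicator ∘ (p ≡ᵇ_)) (trans (cong (_% suc t) (+-comm (suc t) j)) ([m+n]%n≡m%n j (suc t)))

  directed-or-sameClass : ∀ {n} (i j : Fin n) → isDir (orient i j) + indicator (sameClass i j) ≡ 1
  directed-or-sameClass i j with sameClass i j
  ... | true  = refl
  ... | false with toℕ i <ᵇ toℕ j
  ...   | true  = refl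
  ...   | false = refl

  module _ (k : ℕ) where

    directed-degree : ∀ (i : Fin (k * suc t)) → ∑ (allFin (k * suc t)) (λ j → isDir (orient i j)) ≡ k * t
    directed-degree i = +-cancelʳ-≡ k _ _ (begin
      ∑ A (λ j → isDir (orient i j)) + k
        ≡⟨ cong (∑ A (λ j → isDir (orient i j)) +_) class-of-i ⟨
      ∑ A (λ j → isDir (orient i j)) + ∑ A (λ j → indicator (sameClass i j))
        ≡⟨ ∑-distrib-+ A _ _ ⟨
      ∑ A (λ j → isDir (orient i j) + indicator (sameClass i j))
        ≡⟨ ∑-cong A (λ j _ → directed-or-sameClass i j) ⟩
      ∑ A (λ _ → 1)
        ≡⟨ trans (∑-const A 1) (*-identityʳ (length A)) ⟩
      length A
        ≡⟨ length-tabulate {n = k * suc t} id ⟩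
      k * suc t
        ≡⟨ trans (*-suc k t) (+-comm k (k * t)) ⟩
      k * t + k
        ∎)
      where
        open ≡-Reasoning
        A = allFin (k * suc t)
        class-of-i : ∑ A (λ j → indicator (sameClass i j)) ≡ k
        class-of-i = trans (∑-allFin≡sumBelow (k * suc t) (λ x → indicator (part i ≡ᵇ x % suc t)))
                           (class-size k (part i) (m%n<n (toℕ i) (suc t)))

    directed-count : let n = k * suc t
                         D = sumPairs (λ i j → isDir (adj (turánOrientation n) i j))
                     in  D + D ≡ n * (k * t)
    directed-count = begin
      sumPairs dir + sumPairs dir
        ≡⟨ ∑∑-allFin≡sumPairs+sumPairs dir (rev-invariant-sym isDir isDir-rev G) (λ i → cong isDir (loopless G i)) ⟨
      ∑∑ A dir
        ≡⟨ ∑-cong A (λ i _ → directed-degree i) ⟩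
      ∑ A (λ _ → k * t)
        ≡⟨ ∑-const A (k * t) ⟩
      length A * (k * t)
        ≡⟨ cong (_* (k * t)) (length-tabulate {n = k * suc t} id) ⟩
      k * suc t * (k * t)
        ∎
      where
        open ≡-Reasoning
        G = turánOrientation (k * suc t)
        A = allFin (k * suc t)
        dir : Fin (k * suc t) → Fin (k * suc t) → ℕ
        dir i j = isDir (orient i j)

module DensityBounds where

  open import Data.Nat as ℕ using (suc; s≤s)
  import Data.Nat.Properties as ℕ
  open import Data.Integer using (+[1+_])
  open import Data.Rational using (mkℚ; 0ℚ; 1ℚ; _+_; _*_; _-_; -_; _≤_; _<_; Positive; positive; nonNegative)
  open import Data.Rational.Properties
  open import Data.Product using (Σ; ∃; _×_; _,_)
  open import Data.Empty using (⊥-elim)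
  open import Relation.Nullary using (yes; no)
  open import Relation.Binary.PropositionalEquality using (refl; sym; trans; cong)
  import Data.Nat.Combinatorics as Binomial
  open Fraction
  open CountingArithmetic using (density-arithmetic; lower-density-arithmetic)

  weighted-density-≤ : ∀ t₀ m U D c → c ℕ.+ c ≡ (2 ℕ.+ m) ℕ.* suc m →
                       suc t₀ ℕ.* (U ℕ.+ U) ℕ.+ (2 ℕ.+ t₀) ℕ.* (D ℕ.+ D)
                         ℕ.≤ suc t₀ ℕ.* ((2 ℕ.+ m) ℕ.* (2 ℕ.+ m)) →
                       frac U c + (1ℚ + frac 1 (suc t₀)) * frac D c ≤ 1ℚ + frac 1 (suc m)
  weighted-density-≤ t₀ m U D (suc c) 2c≡ count≤ = begin
    frac U C + (1ℚ + frac 1 T) * frac D C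
      ≡⟨ cong (λ ρ → frac U C + ρ * frac D C) (1+frac 1 t₀) ⟩
    frac U C + frac (T ℕ.+ 1) T * frac D C
      ≡⟨ cong (frac U C +_) (frac-* (T ℕ.+ 1) D t₀ c) ⟩
    frac U C + frac ((T ℕ.+ 1) ℕ.* D) (T ℕ.* C)
      ≡⟨ frac-+ U ((T ℕ.+ 1) ℕ.* D) c (ℕ.pred (T ℕ.* C)) ⟩
    frac numerator (C ℕ.* (T ℕ.* C))
      ≤⟨ frac-≤ numerator (suc m ℕ.+ 1) (ℕ.pred (C ℕ.* (T ℕ.* C))) m (density-arithmetic T m U D C 2c≡ count≤) ⟩
    frac (suc m ℕ.+ 1) (suc m)
      ≡⟨ 1+frac 1 m ⟨
    1ℚ + frac 1 (suc m)
      ∎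
    where
      open ≤-Reasoning
      T = suc t₀
      C = suc c
      numerator = U ℕ.* (T ℕ.* C) ℕ.+ (T ℕ.+ 1) ℕ.* D ℕ.* C

  α-nonNeg : ∀ {n} (G : MixedGraph n) → 0ℚ ≤ α G
  α-nonNeg {n} G = frac-nonNeg (sumPairs (λ i j → isUnd (adj G i j))) (Binomial._C_ n 2)

  limsup-from-rate : ∀ {k} (F : MixedGraph k) ρ →
                     (∀ m (G : MixedGraph (2 ℕ.+ m)) → Free F G → α G + ρ * β G ≤ 1ℚ + frac 1 (suc m)) →
                     LimsupAtMostOne F ρ
  limsup-from-rate F ρ rate ε@(mkℚ +[1+ p ] q _) _ = 2 ℕ.+ q , eventually
    where
      open ≤-Reasoning
      eventually : ∀ n → 2 ℕ.+ q ℕ.≤ n → ∀ (G : MixedGraph n) → Free F G → α G + ρ * β G ≤ 1ℚ + ε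
      eventually (suc (suc m)) (s≤s (s≤s q≤m)) G free = ≤-trans (rate m G free) (+-monoʳ-≤ 1ℚ (begin
        frac 1 (suc m)         ≤⟨ frac-≤ 1 (suc p) m q (ℕ.≤-trans (ℕ.≤-reflexive (ℕ.*-identityˡ (suc q)))
                                                            (ℕ.≤-trans (s≤s q≤m) (ℕ.m≤n*m (suc m) (suc p)))) ⟩
        frac (suc p) (suc q)   ≡⟨ fromℚᵘ-toℚᵘ ε ⟩
        ε                      ∎))

  1+[p-1]≡p : ∀ p → 1ℚ + (p - 1ℚ) ≡ p
  1+[p-1]≡p p = trans (+-comm 1ℚ (p - 1ℚ)) (trans (+-assoc p (- 1ℚ) 1ℚ) (trans (cong (p +_) (+-inverseˡ 1ℚ)) (+-identityʳ p)))

  1<p⇒positive[p-1] : ∀ {p} → 1ℚ < p → Positive (p - 1ℚ)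
  1<p⇒positive[p-1] 1<p = positive (≤-<-trans (≤-reflexive (sym (+-inverseʳ 1ℚ))) (+-monoˡ-< (- 1ℚ) 1<p))

  -- If ρq > 1, pick 1 + ε strictly between 1 and ρq: the large graphs of density q violate
  -- α + ρβ ≤ 1 + ε.
  limsup⇒*-≤-1 : ∀ {k} (F : MixedGraph k) q → Positive q →
                 (∀ N → ∃ λ n → N ℕ.≤ n × Σ (MixedGraph n) λ G → Free F G × q ≤ β G) →
                 ∀ ρ → LimsupAtMostOne F ρ → ρ * q ≤ 1ℚ
  limsup⇒*-≤-1 F q q>0 large ρ lim with ρ * q ≤? 1ℚ
  ... | yes ρq≤1 = ρq≤1
  ... | no  ρq≰1
    with mid , 1<mid , mid<ρq ← <-dense (≰⇒> ρq≰1)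
    with N , bound ← lim (mid - 1ℚ) (1<p⇒positive[p-1] 1<mid)
    with n , N≤n , G , free , q≤β ← large N
    = ⊥-elim (<-irrefl refl (begin-strict
      ρ * q               ≡⟨ +-identityˡ (ρ * q) ⟨
      0ℚ + ρ * q          ≤⟨ +-mono-≤ (α-nonNeg G) (*-monoˡ-≤-nonNeg ρ {{nonNegative (<⇒≤ ρ>0)}} q≤β) ⟩
      α G + ρ * β G       ≤⟨ bound n N≤n G free ⟩
      1ℚ + (mid - 1ℚ)     ≡⟨ 1+[p-1]≡p mid ⟩
      mid                 <⟨ mid<ρq ⟩
      ρ * q               ∎))
    where
      open ≤-Reasoning
      ρ>0 : 0ℚ < ρ
      ρ>0 = *-cancelʳ-<-nonNeg q {{pos⇒nonNeg q {{q>0}}}}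
              (≤-<-trans (≤-reflexive (*-zeroˡ q)) (<-trans (positive⁻¹ 1ℚ) (≰⇒> ρq≰1)))

  frac-≥-lower-density : ∀ t₀ k D c → let t = suc t₀; n = suc k ℕ.* suc t in
                         c ℕ.+ c ≡ n ℕ.* ℕ.pred n → D ℕ.+ D ≡ n ℕ.* (suc k ℕ.* t) → frac t (suc t) ≤ frac D c
  frac-≥-lower-density t₀ k D (suc c) 2c≡ 2D≡ =
    frac-≤ (suc t₀) D (suc t₀) c (lower-density-arithmetic (suc t₀) (suc k) D (suc c) 2c≡ 2D≡)

module Theta (t₀ : ℕ) where

  open import Data.Nat as ℕ using (suc; s≤s)
  import Data.Nat.Properties as ℕ
  open import Data.Nat.Combinatorics using (_C_)
  open import Data.Rational using (1ℚ; _+_; _*_; _≤_; Positive)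
  open import Data.Rational.Properties using (*-cancelʳ-≤-pos; normalize-pos; module ≤-Reasoning)
  open import Data.Product using (Σ; ∃; _×_; _,_)
  open import Relation.Binary.PropositionalEquality using (cong; module ≡-Reasoning)
  open import Data.Nat.Tactic.RingSolver using (solve-∀)
  open CountingArithmetic using (nC2+nC2≡n*pred[n])
  open Fraction
  open DensityBounds
  open TuránOrientation (suc t₀)

  t = suc t₀
  ρ₀ = 1ℚ + frac 1 t
  q = frac t (suc t)

  ρ₀-limsup : LimsupAtMostOne (KrArrow (2 ℕ.+ t)) ρ₀
  ρ₀-limsup = limsup-from-rate (KrArrow (2 ℕ.+ t)) ρ₀ λ m G free →
    weighted-density-≤ t₀ m _ _ ((2 ℕ.+ m) C 2) (nC2+nC2≡n*pred[n] (2 ℕ.+ m)) (ArrowFreeGraphs.free⇒edge-count-≤ G t free)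

  ρ₀*q≡1 : ρ₀ * q ≡ 1ℚ
  ρ₀*q≡1 = begin
    ρ₀ * q                                  ≡⟨ cong (_* q) (1+frac 1 t₀) ⟩
    frac (t ℕ.+ 1) t * frac t (suc t)       ≡⟨ frac-* (t ℕ.+ 1) t t₀ t ⟩
    frac ((t ℕ.+ 1) ℕ.* t) (t ℕ.* suc t)    ≡⟨ frac-≡ ((t ℕ.+ 1) ℕ.* t) 1 (ℕ.pred (t ℕ.* suc t)) 0 (cross t₀) ⟩
    1ℚ                                      ∎
    where
      open ≡-Reasoning
      cross : ∀ t₀ → (suc t₀ ℕ.+ 1) ℕ.* suc t₀ ℕ.* 1 ≡ 1 ℕ.* (suc t₀ ℕ.* suc (suc t₀))
      cross = solve-∀

  q>0 : Positive q
  q>0 = normalize-pos t (suc t)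

  large-free-graphs : ∀ N → ∃ λ n → N ℕ.≤ n × Σ (MixedGraph n) λ G → Free (KrArrow (2 ℕ.+ t)) G × q ≤ β G
  large-free-graphs N = n , ℕ.≤-trans (ℕ.n≤1+n N) (ℕ.m≤m*n (suc N) (suc t)) , turánOrientation n , turánOrientation-free n ,
                        frac-≥-lower-density t₀ N _ (n C 2) (nC2+nC2≡n*pred[n] n) (directed-count (suc N))
    where n = suc N ℕ.* suc t

  ρ₀-maximal : ∀ ρ → LimsupAtMostOne (KrArrow (2 ℕ.+ t)) ρ → ρ ≤ ρ₀
  ρ₀-maximal ρ lim = *-cancelʳ-≤-pos q {{q>0}} (begin
    ρ * q    ≤⟨ limsup⇒*-≤-1 (KrArrow (2 ℕ.+ t)) q q>0 large-free-graphs ρ lim ⟩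
    1ℚ       ≡⟨ ρ₀*q≡1 ⟨
    ρ₀ * q   ∎)
    where open ≤-Reasoning

open import Data.Nat using (_∸_; suc; s≤s) renaming (_≤_ to _≤ℕ_)
open import Data.Rational using (1ℚ; _+_)
open import Data.Product using (_,_)

corollary3p6 : ∀ (r : ℕ) → 3 ≤ℕ r → ThetaIs (KrArrow r) (1ℚ + frac 1 (r ∸ 2))
corollary3p6 (suc (suc (suc t₀))) (s≤s (s≤s (s≤s _))) = ρ₀-limsup , ρ₀-maximal
  where open Theta t₀
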